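{- For every integer $n\ge0$, \[ M_{H,n}^{(3)}=bM_{h,n}^{(3)}+(c-rb)M_{h,n-1}^{(3)}+taM_{h,n-2}^{(3)} \quad\text{and}\quad M_{H,n}^{(3)}=aM_{h,n+1}^{(3)}+(b-ra)M_{h,n}^{(3)}+(c-rb-sa)M_{h,n-1}^{(3)}. \]
   Context: Let $r,s,t,a,b,c$ be real numbers with $t\neq0$ (the paper also assumes throughout that $\Delta=\frac{r^{3}t}{27}-\frac{r^{2}s^{2}}{108}+\frac{rst}{6}-\frac{s^{3}}{27}+\frac{t^{2}}{4}>0$). The third-order Horadam matrix sequence $(M_{H,n}^{(3)})_{n\ge0}$ of $3\times3$ matrices is defined by $M_{H,n+3}^{(3)}=rM_{H,n+2}^{(3)}+sM_{H,n+1}^{(3)}+tM_{H,n}^{(3)}$ ($n\ge0$) with $M_{H,0}^{(3)}=\begin{bmatrix} b& c-rb& ta\\ a& b-ra& c-rb-sa\\ \frac1t(c-rb-sa)& \frac1t\left(ta-r(c-rb-sa)\right)& \frac1t\left(-sc+(t+rs)b+(s^2-rt)a\right)\end{bmatrix}$, $M_{H,1}^{(3)}=\begin{bmatrix} c& sb+ta& tb\\ b& c-rb& ta\\ a& b-ra& c-rb-sa\end{bmatrix}$, $M_{H,2}^{(3)}=\begin{bmatrix} rc+sb+ta& sc+tb& tc\\ c& sb+ta& tb\\ b& c-rb& ta\end{bmatrix}$. The generalized Tribonacci matrix sequence satisfies $M_{h,n+3}^{(3)}=rM_{h,n+2}^{(3)}+sM_{h,n+1}^{(3)}+tM_{h,n}^{(3)}$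 with $M_{h,0}^{(3)}=I_3$, $M_{h,1}^{(3)}=\begin{bmatrix} r&s&t\\1&0&0\\0&1&0\end{bmatrix}$, $M_{h,2}^{(3)}=\begin{bmatrix} r^2+s& rs+t& rt\\ r&s&t\\ 1&0&0\end{bmatrix}$; since $t\neq0$ it is extended to negative indices by running the recurrence backwards, $M_{h,k}^{(3)}=\frac1t\big(M_{h,k+3}^{(3)}-rM_{h,k+2}^{(3)}-sM_{h,k+1}^{(3)}\big)$ for $k<0$. -}

module Defs where

open import Level using (Level)
open import Algebra.Bundles using (CommutativeRing)
open import Data.Nat using (ℕ; zero; suc)
open import Data.Integer using (ℤ; +_; -[1+_])
open import Data.Fin using (Fin; zero; suc)
open import Data.Product using (_×_; _,_; proj₁)

-- Everything is developed over an arbitrary commutative ring R (the paper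
-- uses the reals).  The hypothesis t ≠ 0 is used in the paper only to divide
-- by t; here it is represented by an explicit inverse  t⁻¹  with  t * t⁻¹ ≈ 1.
module Tribonacci {c ℓ : Level} (R : CommutativeRing c ℓ) where
  open CommutativeRing R

  Mat : Set c
  Mat = Fin 3 → Fin 3 → Carrier

  _≈M_ : Mat → Mat → Set ℓ
  A ≈M B = ∀ i j → A i j ≈ B i j

  infixl 6 _+M_ _-M_
  infixl 7 _·M_

  _+M_ : Mat → Mat → Mat
  (A +M B) i j = A i j + B i j

  _-M_ : Mat → Mat → Mat
  (A -M B) i j = A i j - B i j

  _·M_ : Carrier → Mat → Mat
  (k ·M A) i j = k * A i j

  mat : Carrier → Carrier → Carrier →
        Carrier → Carrier → Carrier →
        Carrier → Carrier → Carrier → Mat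
  mat a00 a01 a02 a10 a11 a12 a20 a21 a22 zero zero = a00
  mat a00 a01 a02 a10 a11 a12 a20 a21 a22 zero (suc zero) = a01
  mat a00 a01 a02 a10 a11 a12 a20 a21 a22 zero (suc (suc zero)) = a02
  mat a00 a01 a02 a10 a11 a12 a20 a21 a22 (suc zero) zero = a10
  mat a00 a01 a02 a10 a11 a12 a20 a21 a22 (suc zero) (suc zero) = a11
  mat a00 a01 a02 a10 a11 a12 a20 a21 a22 (suc zero) (suc (suc zero)) = a12
  mat a00 a01 a02 a10 a11 a12 a20 a21 a22 (suc (suc zero)) zero = a20
  mat a00 a01 a02 a10 a11 a12 a20 a21 a22 (suc (suc zero)) (suc zero) = a21
  mat a00 a01 a02 a10 a11 a12 a20 a21 a22 (suc (suc zero)) (suc (suc zero)) = a22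

  -- forward iteration of X_{n+3} = r X_{n+2} + s X_{n+1} + t X_n:
  -- fwd n = (X_n , X_{n+1} , X_{n+2})
  fwd : (r s t : Carrier) → Mat → Mat → Mat → ℕ → Mat × Mat × Mat
  fwd r s t X0 X1 X2 zero = X0 , X1 , X2
  fwd r s t X0 X1 X2 (suc n) with fwd r s t X0 X1 X2 n
  ... | (x , y , z) = y , z , (r ·M z +M s ·M y +M t ·M x)

  -- backward iteration X_k = t⁻¹ (X_{k+3} - r X_{k+2} - s X_{k+1}):
  -- bwd m = (X_{-m} , X_{-m+1} , X_{-m+2})
  bwd : (r s tinv : Carrier) → Mat → Mat → Mat → ℕ → Mat × Mat × Mat
  bwd r s tinv X0 X1 X2 zero = X0 , X1 , X2
  bwd r s tinv X0 X1 X2 (suc m) with bwd r s tinv X0 X1 X2 m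
  ... | (x , y , z) = tinv ·M (z -M r ·M y -M s ·M x) , x , y

  Mh0 Mh1 Mh2 : (r s t : Carrier) → Mat
  Mh0 r s t = mat 1# 0# 0#  0# 1# 0#  0# 0# 1#
  Mh1 r s t = mat r s t  1# 0# 0#  0# 1# 0#
  Mh2 r s t = mat (r * r + s) (r * s + t) (r * t)  r s t  1# 0# 0#

  Mh : (r s t tinv : Carrier) → ℤ → Mat
  Mh r s t tinv (+ n) = proj₁ (fwd r s t (Mh0 r s t) (Mh1 r s t) (Mh2 r s t) n)
  Mh r s t tinv -[1+ m ] = proj₁ (bwd r s tinv (Mh0 r s t) (Mh1 r s t) (Mh2 r s t) (suc m))

  MH0 MH1 MH2 : (r s t tinv a b c : Carrier) → Mat
  MH0 r s t tinv a b c =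
    mat b (c - r * b) (t * a)
        a (b - r * a) (c - r * b - s * a)
        (tinv * (c - r * b - s * a))
        (tinv * (t * a - r * (c - r * b - s * a)))
        (tinv * (- (s * c) + (t + r * s) * b + (s * s - r * t) * a))
  MH1 r s t tinv a b c =
    mat c (s * b + t * a) (t * b)
        b (c - r * b) (t * a)
        a (b - r * a) (c - r * b - s * a)
  MH2 r s t tinv a b c =
    mat (r * c + s * b + t * a) (s * c + t * b) (t * c)
        c (s * b + t * a) (t * b)
        b (c - r * b) (t * a)

  MH : (r s t tinv a b c : Carrier) → ℕ → Mat
  MH r s t tinv a b c n =
    proj₁ (fwd r s t (MH0 r s t tinv a b c) (MH1 r s t tinv a b c) (MH2 r s t tinv a b c) n)

module Submission where

open import Defs
open import Level using (Level)
open import Algebra.Bundles using (CommutativeRing)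
open import Algebra.Solver.Ring.AlmostCommutativeRing
  using (fromCommutativeRing; _-Raw-AlmostCommutative⟶_)
open import Data.Fin using (zero; suc; #_)
open import Data.Integer.Base as ℤ
  using (ℤ; +_; -[1+_]; _⊖_; _◃_; sign; ∣_∣) renaming (_-_ to _-ℤ_; _+_ to _+ℤ_)
import Data.Integer.Properties as ℤ
open import Data.Maybe.Base using (Maybe; just; nothing)
open import Data.Nat.Base as ℕ using (ℕ; zero; suc)
import Data.Nat.Properties as ℕ
open import Data.Product.Base using (_×_; _,_; proj₁; proj₂)
open import Data.Sign.Base as Sign using (Sign)
open import Data.Vec.Base using (Vec; _∷_; [])
open import Relation.Binary.PropositionalEquality.Core as ≡ using (_≡_)
open import Relation.Nullary.Decidable.Core using (yes; no)

-- Both sides of the second identity satisfy the recurrence in n: the right-hand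
-- side because M_h satisfies it at every index k ≥ -2, the backward steps to
-- M_{h,-1} and M_{h,-2} being undone by t t⁻¹ = 1.  So it suffices to compare
-- them at n = 0, 1, 2, which are ring identities in the entries (at n = 0 only
-- modulo t t⁻¹ = 1).  The first identity then follows by expanding
-- a M_{h,n+1} = a (r M_{h,n} + s M_{h,n-1} + t M_{h,n-2}).

-- The ring solver with integer coefficients, through the canonical map ℤ → R:
-- with coefficients in R itself it cannot tell that a coefficient such as
-- 1# - 1# vanishes, so even x + y - y ≈ x would fail.
module IntegerCoefficients {c ℓ} (R : CommutativeRing c ℓ) where
  open CommutativeRing R
  open import Algebra.Properties.Ring ring
    using (-0#≈0#; -‿involutive; -‿anti-homo-+; -‿distribˡ-*; -‿distribʳ-*)
  open import Algebra.Properties.Semiring.Mult.TCOptimised semiring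
    using (1+×; ×-homo-+; ×1-homo-*) renaming (_×_ to _×ℕ_)
  open import Relation.Binary.Reasoning.Setoid setoid

  fromℤ : ℤ → Carrier
  fromℤ (+ n)    = n ×ℕ 1#
  fromℤ -[1+ n ] = - (suc n ×ℕ 1#)

  private
    [1+x]-[1+y]≈x-y : ∀ x y → (1# + x) - (1# + y) ≈ x - y
    [1+x]-[1+y]≈x-y x y = begin
      (1# + x) - (1# + y)    ≈⟨ +-congʳ (+-comm 1# x) ⟩
      (x + 1#) - (1# + y)    ≈⟨ +-assoc x 1# _ ⟩
      x + (1# - (1# + y))    ≈⟨ +-congˡ (+-congˡ (-‿anti-homo-+ 1# y)) ⟩
      x + (1# + (- y - 1#))  ≈⟨ +-congˡ (+-congˡ (+-comm (- y) (- 1#))) ⟩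
      x + (1# + (- 1# - y))  ≈⟨ +-congˡ (+-assoc 1# (- 1#) (- y)) ⟨
      x + ((1# - 1#) - y)    ≈⟨ +-congˡ (+-congʳ (-‿inverseʳ 1#)) ⟩
      x + (0# - y)           ≈⟨ +-congˡ (+-identityˡ (- y)) ⟩
      x - y                  ∎

  ⊖-homo : ∀ m n → fromℤ (m ⊖ n) ≈ m ×ℕ 1# - n ×ℕ 1#
  ⊖-homo m       zero    = sym (trans (+-congˡ -0#≈0#) (+-identityʳ _))
  ⊖-homo zero    (suc n) = sym (+-identityˡ _)
  ⊖-homo (suc m) (suc n) = begin
    fromℤ (suc m ⊖ suc n)              ≡⟨ ≡.cong fromℤ (ℤ.[1+m]⊖[1+n]≡m⊖n m n) ⟩
    fromℤ (m ⊖ n)                      ≈⟨ ⊖-homo m n ⟩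
    m ×ℕ 1# - n ×ℕ 1#                  ≈⟨ [1+x]-[1+y]≈x-y _ _ ⟨
    (1# + m ×ℕ 1#) - (1# + n ×ℕ 1#)    ≈⟨ +-cong (1+× m 1#) (-‿cong (1+× n 1#)) ⟨
    suc m ×ℕ 1# - suc n ×ℕ 1#          ∎

  +-homo : ∀ i j → fromℤ (i +ℤ j) ≈ fromℤ i + fromℤ j
  +-homo (+ m)    (+ n)    = ×-homo-+ 1# m n
  +-homo (+ m)    -[1+ n ] = ⊖-homo m (suc n)
  +-homo -[1+ m ] (+ n)    = trans (⊖-homo n (suc m)) (+-comm _ _)
  +-homo -[1+ m ] -[1+ n ] = begin
    - (suc (suc m ℕ.+ n) ×ℕ 1#)       ≡⟨ ≡.cong (λ k → - (k ×ℕ 1#)) (ℕ.+-suc (suc m) n) ⟨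
    - ((suc m ℕ.+ suc n) ×ℕ 1#)       ≈⟨ -‿cong (×-homo-+ 1# (suc m) (suc n)) ⟩
    - (suc m ×ℕ 1# + suc n ×ℕ 1#)     ≈⟨ -‿anti-homo-+ _ _ ⟩
    - (suc n ×ℕ 1#) - suc m ×ℕ 1#     ≈⟨ +-comm _ _ ⟩
    - (suc m ×ℕ 1#) - suc n ×ℕ 1#     ∎

  -‿homo : ∀ i → fromℤ (ℤ.- i) ≈ - fromℤ i
  -‿homo (+ zero)  = sym -0#≈0#
  -‿homo (+ suc n) = refl
  -‿homo -[1+ n ]  = sym (-‿involutive _)

  signed : Sign → Carrier → Carrier
  signed Sign.+ x = x
  signed Sign.- x = - x

  signed-cong : ∀ σ {x y} → x ≈ y → signed σ x ≈ signed σ y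
  signed-cong Sign.+ x≈y = x≈y
  signed-cong Sign.- x≈y = -‿cong x≈y

  signed-* : ∀ σ τ x y → signed (σ Sign.* τ) (x * y) ≈ signed σ x * signed τ y
  signed-* Sign.+ Sign.+ x y = refl
  signed-* Sign.+ Sign.- x y = -‿distribʳ-* x y
  signed-* Sign.- Sign.+ x y = -‿distribˡ-* x y
  signed-* Sign.- Sign.- x y = begin
    x * y          ≈⟨ -‿involutive _ ⟨
    - - (x * y)    ≈⟨ -‿cong (-‿distribʳ-* x y) ⟩
    - (x * - y)    ≈⟨ -‿distribˡ-* x (- y) ⟩
    - x * - y      ∎

  fromℤ-◃ : ∀ σ n → fromℤ (σ ◃ n) ≈ signed σ (n ×ℕ 1#)
  fromℤ-◃ Sign.+ zero    = refl
  fromℤ-◃ Sign.- zero    = sym -0#≈0#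
  fromℤ-◃ Sign.+ (suc n) = refl
  fromℤ-◃ Sign.- (suc n) = refl

  signed-sign-∣∣ : ∀ i → signed (sign i) (∣ i ∣ ×ℕ 1#) ≡ fromℤ i
  signed-sign-∣∣ (+ n)    = ≡.refl
  signed-sign-∣∣ -[1+ n ] = ≡.refl

  *-homo : ∀ i j → fromℤ (i ℤ.* j) ≈ fromℤ i * fromℤ j
  *-homo i j = begin
    fromℤ (σ ◃ ∣ i ∣ ℕ.* ∣ j ∣)
      ≈⟨ fromℤ-◃ σ (∣ i ∣ ℕ.* ∣ j ∣) ⟩
    signed σ ((∣ i ∣ ℕ.* ∣ j ∣) ×ℕ 1#)
      ≈⟨ signed-cong σ (×1-homo-* ∣ i ∣ ∣ j ∣) ⟩
    signed σ (∣ i ∣ ×ℕ 1# * ∣ j ∣ ×ℕ 1#)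
      ≈⟨ signed-* (sign i) (sign j) _ _ ⟩
    signed (sign i) (∣ i ∣ ×ℕ 1#) * signed (sign j) (∣ j ∣ ×ℕ 1#)
      ≡⟨ ≡.cong₂ _*_ (signed-sign-∣∣ i) (signed-sign-∣∣ j) ⟩
    fromℤ i * fromℤ j
      ∎
    where σ = sign i Sign.* sign j

  fromℤ-morphism : ℤ.+-*-rawRing -Raw-AlmostCommutative⟶ fromCommutativeRing R
  fromℤ-morphism = record
    { ⟦_⟧ = fromℤ ; +-homo = +-homo ; *-homo = *-homo ; -‿homo = -‿homo
    ; 0-homo = refl ; 1-homo = refl
    }

  fromℤ-≟ : ∀ i j → Maybe (fromℤ i ≈ fromℤ j)
  fromℤ-≟ i j with i ℤ.≟ j
  ... | yes ≡.refl = just refl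
  ... | no _       = nothing

  open import Algebra.Solver.Ring ℤ.+-*-rawRing (fromCommutativeRing R) fromℤ-morphism fromℤ-≟ public

  0̂ 1̂ : ∀ {n} → Polynomial n
  0̂ = con (+ 0)
  1̂ = con (+ 1)

module _ {ℓc ℓ} (R : CommutativeRing ℓc ℓ) where
  open CommutativeRing R
  open Tribonacci R
  open import Algebra.Properties.Ring ring using (+-cancelʳ)
  open IntegerCoefficients R
    using (Polynomial; var; prove; solve; _:=_; _:+_; _:*_; _:-_; :-_; 0̂; 1̂)
    renaming (⟦_⟧ to ⟦_⟧ₚ; ⟦_⟧↓ to ⟦_⟧ₚ↓)

  module LinearRecurrence (r s t : Carrier) where

    step : Mat → Mat → Mat → Mat
    step x y z = r ·M z +M s ·M y +M t ·M x

    Recurrent : (ℕ → Mat) → Set ℓ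
    Recurrent X = ∀ n → X (3 ℕ.+ n) ≈M step (X n) (X (1 ℕ.+ n)) (X (2 ℕ.+ n))

    step-cong : ∀ {x x′ y y′ z z′} →
      x ≈M x′ → y ≈M y′ → z ≈M z′ → step x y z ≈M step x′ y′ z′
    step-cong x≈x′ y≈y′ z≈z′ i j =
      +-cong (+-cong (*-congˡ (z≈z′ i j)) (*-congˡ (y≈y′ i j))) (*-congˡ (x≈x′ i j))

    fwd-recurrent : ∀ X₀ X₁ X₂ → Recurrent (λ n → proj₁ (fwd r s t X₀ X₁ X₂ n))
    fwd-recurrent X₀ X₁ X₂ n i j = refl

    recurrent-unique : ∀ {X Y} → Recurrent X → Recurrent Y →
      X 0 ≈M Y 0 → X 1 ≈M Y 1 → X 2 ≈M Y 2 → ∀ n → X n ≈M Y n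
    recurrent-unique {X} {Y} X-rec Y-rec X₀≈Y₀ X₁≈Y₁ X₂≈Y₂ = agree
      where
      agree : ∀ n → X n ≈M Y n
      agree 0 = X₀≈Y₀
      agree 1 = X₁≈Y₁
      agree 2 = X₂≈Y₂
      agree (suc (suc (suc n))) i j = trans (X-rec n i j)
        (trans (step-cong (agree n) (agree (suc n)) (agree (suc (suc n))) i j) (sym (Y-rec n i j)))

    combination : Carrier → Carrier → Carrier → (ℕ → Mat) → ℕ → Mat
    combination α β γ X n = α ·M X (2 ℕ.+ n) +M β ·M X (1 ℕ.+ n) +M γ ·M X n

    recurrent-combination : ∀ α β γ {X} → Recurrent X → Recurrent (combination α β γ X)
    recurrent-combination α β γ {X} X-rec n i j = trans
      (+-cong (+-cong (*-congˡ (X-rec (2 ℕ.+ n) i j)) (*-congˡ (X-rec (1 ℕ.+ n) i j)))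
              (*-congˡ (X-rec n i j)))
      (solve 11 (λ r s t α β γ x₀ x₁ x₂ x₃ x₄ →
          α :* (r :* x₄ :+ s :* x₃ :+ t :* x₂) :+ β :* (r :* x₃ :+ s :* x₂ :+ t :* x₁)
            :+ γ :* (r :* x₂ :+ s :* x₁ :+ t :* x₀)
        := r :* (α :* x₄ :+ β :* x₃ :+ γ :* x₂) :+ s :* (α :* x₃ :+ β :* x₂ :+ γ :* x₁)
            :+ t :* (α :* x₂ :+ β :* x₁ :+ γ :* x₀))
        refl r s t α β γ
        (X n i j) (X (1 ℕ.+ n) i j) (X (2 ℕ.+ n) i j) (X (3 ℕ.+ n) i j) (X (4 ℕ.+ n) i j))

  module Horadam (r s t ti a b c : Carrier) (t*ti≈1 : t * ti ≈ 1#) where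
    open LinearRecurrence r s t

    t*[ti*x]≈x : ∀ x → t * (ti * x) ≈ x
    t*[ti*x]≈x x = trans (sym (*-assoc t ti x)) (trans (*-congʳ t*ti≈1) (*-identityˡ x))

    x+u*[t*ti]≈y+u⇒x≈y : ∀ {x y} u → x + u * (t * ti) ≈ y + u → x ≈ y
    x+u*[t*ti]≈y+u⇒x≈y {x} {y} u eq =
      +-cancelʳ u x y (trans (+-congˡ (sym (trans (*-congˡ t*ti≈1) (*-identityʳ u)))) eq)

    backward-step : ∀ x y z → z ≈ r * y + s * x + t * (ti * (z - r * y - s * x))
    backward-step x y z = sym (trans (+-congˡ (t*[ti*x]≈x _))
      (solve 5 (λ r s x y z → r :* y :+ s :* x :+ (z :- r :* y :- s :* x) := z) refl r s x y z))

    Mh′ : ℕ → Mat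
    Mh′ n = Mh r s t ti (+ n -ℤ + 2)

    Mh′-recurrent : Recurrent Mh′
    Mh′-recurrent 0 i j = backward-step _ _ _
    Mh′-recurrent 1 i j = backward-step _ _ _
    Mh′-recurrent (suc (suc n)) = fwd-recurrent (Mh0 r s t) (Mh1 r s t) (Mh2 r s t) n

    MH′ : ℕ → Mat
    MH′ = MH r s t ti a b c

    β′ γ′ : Carrier
    β′ = b - r * a
    γ′ = c - r * b - s * a

    expansion₁ expansion₂ : ℕ → Mat
    expansion₁ = combination b (c - r * b) (t * a) Mh′
    expansion₂ = combination a β′ γ′ (λ n → Mh′ (suc n))

    expansion₂≈expansion₁ : ∀ n → expansion₂ n ≈M expansion₁ n
    expansion₂≈expansion₁ n i j = trans (+-congʳ (+-congʳ (*-congˡ (Mh′-recurrent n i j))))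
      (solve 9 (λ r s t a b c y₀ y₁ y₂ →
          a :* (r :* y₂ :+ s :* y₁ :+ t :* y₀) :+ (b :- r :* a) :* y₂
            :+ (c :- r :* b :- s :* a) :* y₁
        := b :* y₂ :+ (c :- r :* b) :* y₁ :+ (t :* a) :* y₀)
        refl r s t a b c (Mh′ n i j) (Mh′ (1 ℕ.+ n) i j) (Mh′ (2 ℕ.+ n) i j))

    ρ : Vec Carrier 7
    ρ = r ∷ s ∷ t ∷ ti ∷ a ∷ b ∷ c ∷ []

    Identity : Set
    Identity = (r s t ti a b c β γ : Polynomial 7) → Polynomial 7 × Polynomial 7

    instantiate : Identity → Polynomial 7 × Polynomial 7
    instantiate f = (λ r s t ti a b c → f r s t ti a b c (b :- r :* a) (c :- r :* b :- s :* a))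
      (var (# 0)) (var (# 1)) (var (# 2)) (var (# 3)) (var (# 4)) (var (# 5)) (var (# 6))

    by-ring : (f : Identity) → let (lhs , rhs) = instantiate f in
      ⟦ lhs ⟧ₚ↓ ρ ≈ ⟦ rhs ⟧ₚ↓ ρ → ⟦ lhs ⟧ₚ ρ ≈ ⟦ rhs ⟧ₚ ρ
    by-ring f = prove ρ (proj₁ (instantiate f)) (proj₂ (instantiate f))

    MH₀≈expansion₂ : MH′ 0 ≈M expansion₂ 0
    MH₀≈expansion₂ zero zero = by-ring (λ r s t ti a b c β γ →
      b := a :* r :+ β :* 1̂ :+ γ :* (ti :* ((r :* r :+ s) :- r :* r :- s :* 1̂))) refl
    MH₀≈expansion₂ zero (suc zero) = x+u*[t*ti]≈y+u⇒x≈y γ′ (by-ring (λ r s t ti a b c β γ →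
      c :- r :* b :+ γ :* (t :* ti)
        := a :* s :+ β :* 0̂ :+ γ :* (ti :* ((r :* s :+ t) :- r :* s :- s :* 0̂)) :+ γ) refl)
    MH₀≈expansion₂ zero (suc (suc zero)) = by-ring (λ r s t ti a b c β γ →
      t :* a := a :* t :+ β :* 0̂ :+ γ :* (ti :* ((r :* t) :- r :* t :- s :* 0̂))) refl
    MH₀≈expansion₂ (suc zero) zero = by-ring (λ r s t ti a b c β γ →
      a := a :* 1̂ :+ β :* 0̂ :+ γ :* (ti :* (r :- r :* 1̂ :- s :* 0̂))) refl
    MH₀≈expansion₂ (suc zero) (suc zero) = by-ring (λ r s t ti a b c β γ →
      β := a :* 0̂ :+ β :* 1̂ :+ γ :* (ti :* (s :- r :* 0̂ :- s :* 1̂))) refl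
    MH₀≈expansion₂ (suc zero) (suc (suc zero)) = x+u*[t*ti]≈y+u⇒x≈y γ′ (by-ring (λ r s t ti a b c β γ →
      γ :+ γ :* (t :* ti)
        := a :* 0̂ :+ β :* 0̂ :+ γ :* (ti :* (t :- r :* 0̂ :- s :* 0̂)) :+ γ) refl)
    MH₀≈expansion₂ (suc (suc zero)) zero = by-ring (λ r s t ti a b c β γ →
      ti :* γ := a :* 0̂ :+ β :* 0̂ :+ γ :* (ti :* (1̂ :- r :* 0̂ :- s :* 0̂))) refl
    MH₀≈expansion₂ (suc (suc zero)) (suc zero) =
      sym (x+u*[t*ti]≈y+u⇒x≈y a (by-ring (λ r s t ti a b c β γ →
        a :* 1̂ :+ β :* 0̂ :+ γ :* (ti :* (0̂ :- r :* 1̂ :- s :* 0̂)) :+ a :* (t :* ti)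
          := ti :* (t :* a :- r :* γ) :+ a) refl))
    MH₀≈expansion₂ (suc (suc zero)) (suc (suc zero)) =
      sym (x+u*[t*ti]≈y+u⇒x≈y β′ (by-ring (λ r s t ti a b c β γ →
        a :* 0̂ :+ β :* 1̂ :+ γ :* (ti :* (0̂ :- r :* 0̂ :- s :* 1̂)) :+ β :* (t :* ti)
          := ti :* (:- (s :* c) :+ (t :+ r :* s) :* b :+ (s :* s :- r :* t) :* a) :+ β) refl))

    MH₁≈expansion₂ : MH′ 1 ≈M expansion₂ 1
    MH₁≈expansion₂ zero zero = by-ring (λ r s t ti a b c β γ →
      c := a :* (r :* r :+ s) :+ β :* r :+ γ :* 1̂) refl
    MH₁≈expansion₂ zero (suc zero) = by-ring (λ r s t ti a b c β γ →
      s :* b :+ t :* a := a :* (r :* s :+ t) :+ β :* s :+ γ :* 0̂) refl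
    MH₁≈expansion₂ zero (suc (suc zero)) = by-ring (λ r s t ti a b c β γ →
      t :* b := a :* (r :* t) :+ β :* t :+ γ :* 0̂) refl
    MH₁≈expansion₂ (suc zero) zero = by-ring (λ r s t ti a b c β γ →
      b := a :* r :+ β :* 1̂ :+ γ :* 0̂) refl
    MH₁≈expansion₂ (suc zero) (suc zero) = by-ring (λ r s t ti a b c β γ →
      c :- r :* b := a :* s :+ β :* 0̂ :+ γ :* 1̂) refl
    MH₁≈expansion₂ (suc zero) (suc (suc zero)) = by-ring (λ r s t ti a b c β γ →
      t :* a := a :* t :+ β :* 0̂ :+ γ :* 0̂) refl
    MH₁≈expansion₂ (suc (suc zero)) zero = by-ring (λ r s t ti a b c β γ →
      a := a :* 1̂ :+ β :* 0̂ :+ γ :* 0̂) refl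
    MH₁≈expansion₂ (suc (suc zero)) (suc zero) = by-ring (λ r s t ti a b c β γ →
      β := a :* 0̂ :+ β :* 1̂ :+ γ :* 0̂) refl
    MH₁≈expansion₂ (suc (suc zero)) (suc (suc zero)) = by-ring (λ r s t ti a b c β γ →
      γ := a :* 0̂ :+ β :* 0̂ :+ γ :* 1̂) refl

    MH₂≈expansion₂ : MH′ 2 ≈M expansion₂ 2
    MH₂≈expansion₂ zero zero = by-ring (λ r s t ti a b c β γ →
      r :* c :+ s :* b :+ t :* a := a :* (r :* (r :* r :+ s) :+ s :* r :+ t :* 1̂) :+ β :* (r :* r :+ s) :+ γ :* r) refl
    MH₂≈expansion₂ zero (suc zero) = by-ring (λ r s t ti a b c β γ →
      s :* c :+ t :* b := a :* (r :* (r :* s :+ t) :+ s :* s :+ t :* 0̂) :+ β :* (r :* s :+ t) :+ γ :* s) refl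
    MH₂≈expansion₂ zero (suc (suc zero)) = by-ring (λ r s t ti a b c β γ →
      t :* c := a :* (r :* (r :* t) :+ s :* t :+ t :* 0̂) :+ β :* (r :* t) :+ γ :* t) refl
    MH₂≈expansion₂ (suc zero) zero = by-ring (λ r s t ti a b c β γ →
      c := a :* (r :* r :+ s :* 1̂ :+ t :* 0̂) :+ β :* r :+ γ :* 1̂) refl
    MH₂≈expansion₂ (suc zero) (suc zero) = by-ring (λ r s t ti a b c β γ →
      s :* b :+ t :* a := a :* (r :* s :+ s :* 0̂ :+ t :* 1̂) :+ β :* s :+ γ :* 0̂) refl
    MH₂≈expansion₂ (suc zero) (suc (suc zero)) = by-ring (λ r s t ti a b c β γ →
      t :* b := a :* (r :* t :+ s :* 0̂ :+ t :* 0̂) :+ β :* t :+ γ :* 0̂) refl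
    MH₂≈expansion₂ (suc (suc zero)) zero = by-ring (λ r s t ti a b c β γ →
      b := a :* (r :* 1̂ :+ s :* 0̂ :+ t :* 0̂) :+ β :* 1̂ :+ γ :* 0̂) refl
    MH₂≈expansion₂ (suc (suc zero)) (suc zero) = by-ring (λ r s t ti a b c β γ →
      c :- r :* b := a :* (r :* 0̂ :+ s :* 1̂ :+ t :* 0̂) :+ β :* 0̂ :+ γ :* 1̂) refl
    MH₂≈expansion₂ (suc (suc zero)) (suc (suc zero)) = by-ring (λ r s t ti a b c β γ →
      t :* a := a :* (r :* 0̂ :+ s :* 0̂ :+ t :* 1̂) :+ β :* 0̂ :+ γ :* 0̂) refl
    MH≈expansion₂ : ∀ n → MH′ n ≈M expansion₂ n
    MH≈expansion₂ = recurrent-unique (fwd-recurrent _ _ _)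
      (recurrent-combination _ _ _ (λ n → Mh′-recurrent (suc n)))
      MH₀≈expansion₂ MH₁≈expansion₂ MH₂≈expansion₂

    MH≈expansion₁ : ∀ n → MH′ n ≈M expansion₁ n
    MH≈expansion₁ n i j = trans (MH≈expansion₂ n i j) (expansion₂≈expansion₁ n i j)

theorem3p2 : {ℓc ℓ : Level} (R : CommutativeRing ℓc ℓ) →
    let open CommutativeRing R in let open Tribonacci R in
    (r s t tinv a b c : Carrier) → t * tinv ≈ 1# → (n : ℕ) →
      (MH r s t tinv a b c n ≈M
        (b ·M Mh r s t tinv (+ n)
          +M (c - r * b) ·M Mh r s t tinv (+ n -ℤ + 1)
          +M (t * a) ·M Mh r s t tinv (+ n -ℤ + 2)))
      × (MH r s t tinv a b c n ≈M
        (a ·M Mh r s t tinv (+ n +ℤ + 1)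
          +M (b - r * a) ·M Mh r s t tinv (+ n)
          +M (c - r * b - s * a) ·M Mh r s t tinv (+ n -ℤ + 1)))
-- Splitting on n makes the indices n - 1 and n - 2 compute; n + 1 also needs n + 1 ≡ 1 + n.
theorem3p2 R r s t tinv a b c t*tinv≈1 zero =
  MH≈expansion₁ 0 , MH≈expansion₂ 0
  where open Horadam R r s t tinv a b c t*tinv≈1
theorem3p2 R r s t tinv a b c t*tinv≈1 (suc n) rewrite ℕ.+-comm n 1 =
  MH≈expansion₁ (suc n) , MH≈expansion₂ (suc n)
  where open Horadam R r s t tinv a b c t*tinv≈1
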